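{- Let $T\subseteq\omega^{<\omega}$ be a tree and let $\mathcal{A}(T)=(G,(f_a)_{a\in G})$ be the associated structure, with the tree structure on $G$ given by the predecessor function $p$. Let $n\ge 1$ and $a\in G_n$ with $a\neq id_n$. Then the rank of $a$ in the tree $(G,p)$ equals $\min\{rk(t): t\in a\}$, where $rk(t)$ is the rank of $t$ in $T$.
   Context: For a tree $T\subseteq\omega^{<\omega}$ let $T_n$ be the set of nodes of length $n$. $G_n$ is the set of finite subsets of $T_n$, an abelian group under symmetric difference $\triangle$ with identity $\emptyset$; for distinct $n>0$ the empty set in $G_n$ is replaced by distinct new elements $id_n$, and $G_0=\{\emptyset\}=\{id_0\}$. $G=\bigcup_n G_n$. The predecessor map $p:G_{n+1}\to G_n$: for nonempty $a=\{t_1,\dots,t_k\}\in G_{n+1}$ where $t_i'$ is the predecessor of $t_i$ in $T$, $p(a)=\{t_1'\}\triangle\cdots\triangle\{t_k'\}$ in $G_n$ (with $\emptyset$ written $id_n$), and $p(id_{n+1})=id_n$; thus $p$ is a homomorphism $G_{n+1}\to G_n$. For $a\in G_n$ and $b\in G_m$, let $k=\min\{m,n\}$, $a^*=p^{(n-k)}(a)$, $b^*=p^{(m-k)}(b)$, and $f_a(b)=a^*\triangle b^*$. $\mathcal{A}(T)=(G,(f_a)_{a\in G})$. The successors of $a\in G_n$ in $(G,p)$ are the $b\in G_{n+1}$ with $p(b)=a$. Tree rank (in $T$, or in $(G,p)$): $rk(\sigma)=0$ if $\sigma$ has no successors; for $\alpha>0$, $rk(\sigma)=\alpha$ if $\alpha$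 is the least ordinal greater than $rk(\tau)$ for all successors $\tau$ of $\sigma$; $rk(\sigma)=\infty$ if $\sigma$ receives no ordinal rank, with $\infty\ge\alpha$ for all ordinals $\alpha$. -}

module Defs where

open import Data.Nat using (ℕ; zero; suc)
import Data.Nat.Properties as ℕP
open import Data.List using (List; []; _∷_; _++_; [_]; length; filter; foldr)
open import Data.List.Properties using (≡-dec)
open import Data.List.Relation.Unary.All using (All)
open import Data.List.Relation.Unary.Unique.Propositional using (Unique)
open import Data.Product using (Σ; _×_; ∃)
open import Data.Unit using (⊤)
open import Relation.Binary.PropositionalEquality using (_≡_)
open import Relation.Binary.Definitions using (DecidableEquality)
open import Function.Bundles using (_⇔_)

Node : Set
Node = List ℕ

_≟N_ : DecidableEquality Node
_≟N_ = ≡-dec ℕP._≟_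

open import Data.List.Membership.DecPropositional _≟N_ public
  using (_∈_; _∉_; _∈?_; _∉?_)

predN : Node → Node
predN []           = []
predN (x ∷ [])     = []
predN (x ∷ y ∷ xs) = x ∷ predN (y ∷ xs)

record Tree : Set₁ where
  field
    mem           : Node → Set
    prefix-closed : ∀ σ k → mem (σ ++ [ k ]) → mem σ
open Tree public

TSucc : Tree → Node → Node → Set
TSucc T σ τ = mem T τ × ∃ λ k → τ ≡ σ ++ [ k ]

-- Countable ordinals (Brouwer trees) and tree rank.
-- RankGE Succ x α  means  rk(x) ≥ α  (rank taking values in ordinals ∪ {∞});
-- rk(x) = ∞ iff RankGE Succ x α for all α.

data Ord : Set where
  zer : Ord
  osuc : Ord → Ord
  lim : (ℕ → Ord) → Ord

RankGE : {X : Set} → (X → X → Set) → X → Ord → Set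
RankGE Succ x zer      = ⊤
RankGE Succ x (osuc α) = Σ _ λ y → Succ x y × RankGE Succ y α
RankGE Succ x (lim f)  = ∀ n → RankGE Succ x (f n)

-- The groups G_n.  A finite subset of T_n is a duplicate-free list of
-- nodes of T of length n; sets are compared extensionally.

_△_ : List Node → List Node → List Node
a △ b = filter (_∉? b) a ++ filter (_∉? a) b

SetEq : List Node → List Node → Set
SetEq a b = ∀ x → (x ∈ a) ⇔ (x ∈ b)

pSet : List Node → List Node
pSet b = foldr (λ t acc → [ predN t ] △ acc) [] b

-- An element of G = ⋃ G_n: the level n is recorded, so that the empty
-- sets at distinct levels are the distinct identities id_n.
record GElem (T : Tree) : Set where
  field
    level  : ℕ
    elems  : List Node
    inT    : All (mem T) elems
    len    : All (λ t → length t ≡ level) elems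
    unique : Unique elems
open GElem public

GSucc : (T : Tree) → GElem T → GElem T → Set
GSucc T a b = level b ≡ suc (level a) × SetEq (pSet (elems b)) (elems a)

{-# OPTIONS --safe #-}
-- A successor b of a in (G, p) consists of children of nodes of a, and since p(b) = a every node
-- of a has a child in b.  Conversely, choosing one child of each node of a gives a successor of a:
-- the chosen children have pairwise distinct predecessors, so nothing cancels in the symmetric
-- difference defining p.  Hence, by induction on α, rk(a) ≥ α iff rk(t) ≥ α for every t ∈ a.
module Submission where

open import Defs
open import Data.Nat using (_≤_; suc)
open import Data.Nat.Properties using (+-comm)
open import Data.List using (List; []; _∷_; _++_; [_]; length; map; filter)
open import Data.List.Properties using (length-++)
open import Data.List.Relation.Unary.All as All using (All; []; _∷_)
open import Data.List.Relation.Unary.Any using (here; there)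
open import Data.List.Relation.Unary.AllPairs using (_∷_)
open import Data.List.Relation.Unary.Unique.Propositional using (Unique)
open import Data.List.Relation.Unary.Unique.Propositional.Properties using (map⁻)
open import Data.List.Membership.Propositional.Properties
  using (∈-filter⁺; ∈-filter⁻; ∈-++⁺ˡ; ∈-++⁺ʳ; ∈-++⁻; ∈-map⁻)
open import Data.Product using (_×_; ∃; _,_; proj₁; map₂)
open import Data.Sum using (_⊎_; inj₁; inj₂)
open import Data.Unit using (tt)
open import Relation.Binary.PropositionalEquality using (_≡_; refl; sym; trans; cong; cong₂; subst)
open import Relation.Nullary using (¬_)
open import Function.Bundles using (_⇔_; mk⇔; Equivalence)

predN-snoc : ∀ (t : Node) k → predN (t ++ [ k ]) ≡ t
predN-snoc []           k = refl
predN-snoc (x ∷ [])     k = refl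
predN-snoc (x ∷ y ∷ ys) k = cong (x ∷_) (predN-snoc (y ∷ ys) k)

snoc-predN : ∀ {n} (t : Node) → length t ≡ suc n → ∃ λ k → t ≡ predN t ++ [ k ]
snoc-predN (x ∷ [])     _ = x , refl
snoc-predN (x ∷ y ∷ ys) _ = map₂ (cong (x ∷_)) (snoc-predN (y ∷ ys) refl)

length-snoc : ∀ (t : Node) k → length (t ++ [ k ]) ≡ suc (length t)
length-snoc t k = trans (length-++ t) (+-comm (length t) 1)

∈-△⁻ : ∀ {x} a b → x ∈ a △ b → x ∈ a ⊎ x ∈ b
∈-△⁻ a b m with ∈-++⁻ (filter (_∉? b) a) m
... | inj₁ m₁ = inj₁ (proj₁ (∈-filter⁻ (_∉? b) m₁))
... | inj₂ m₂ = inj₂ (proj₁ (∈-filter⁻ (_∉? a) m₂))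

∈-△⁺ˡ : ∀ {x a} b → x ∈ a → x ∉ b → x ∈ a △ b
∈-△⁺ˡ b m n = ∈-++⁺ˡ (∈-filter⁺ (_∉? b) m n)

∈-△⁺ʳ : ∀ {x} a {b} → x ∈ b → x ∉ a → x ∈ a △ b
∈-△⁺ʳ a {b} m n = ∈-++⁺ʳ (filter (_∉? b) a) (∈-filter⁺ (_∉? a) m n)

pSet⊆map-predN : ∀ (b : List Node) {x} → x ∈ pSet b → x ∈ map predN b
pSet⊆map-predN (t ∷ b) m with ∈-△⁻ [ predN t ] (pSet b) m
... | inj₁ m₁ = ∈-++⁺ˡ m₁
... | inj₂ m₂ = there (pSet⊆map-predN b m₂)

map-predN⊆pSet : ∀ (b : List Node) → Unique (map predN b) → ∀ {x} → x ∈ map predN b → x ∈ pSet b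
map-predN⊆pSet (t ∷ b) (t≢ ∷ _) (here refl) =
  ∈-△⁺ˡ (pSet b) (here refl) (λ m → All.lookup t≢ (pSet⊆map-predN b m) refl)
map-predN⊆pSet (t ∷ b) (t≢ ∷ u) (there m) =
  ∈-△⁺ʳ [ predN t ] (map-predN⊆pSet b u m) (λ { (here eq) → All.lookup t≢ m (sym eq) })

pSet-unique : ∀ (b : List Node) → Unique (map predN b) → SetEq (pSet b) (map predN b)
pSet-unique b u x = mk⇔ (pSet⊆map-predN b) (map-predN⊆pSet b u)

module _ (T : Tree) where

  HasChild : (Node → Set) → Node → Set
  HasChild Q t = ∃ λ y → TSucc T t y × Q y

  child-in-successor : ∀ {a b t} → GSucc T a b → t ∈ elems a → ∃ λ y → y ∈ elems b × TSucc T t y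
  child-in-successor {a} {b} {t} (lv , p[b]≐a) t∈a
    with ∈-map⁻ predN (pSet⊆map-predN (elems b) (Equivalence.from (p[b]≐a t) t∈a))
  ... | y , y∈b , refl =
    y , y∈b , All.lookup (inT b) y∈b , snoc-predN y (trans (All.lookup (len b) y∈b) lv)

  module _ {Q : Node → Set} where

    children : ∀ {xs} → All (HasChild Q) xs → List Node
    children = All.reduce proj₁

    predN-children : ∀ {xs} (H : All (HasChild Q) xs) → map predN (children H) ≡ xs
    predN-children []                             = refl
    predN-children ((_ , (_ , k , refl) , _) ∷ H) = cong₂ _∷_ (predN-snoc _ k) (predN-children H)

    children-mem : ∀ {xs} (H : All (HasChild Q) xs) → All (mem T) (children H)
    children-mem []                      = []
    children-mem ((_ , (m , _) , _) ∷ H) = m ∷ children-mem H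

    children-Q : ∀ {xs} (H : All (HasChild Q) xs) → All Q (children H)
    children-Q []                = []
    children-Q ((_ , _ , q) ∷ H) = q ∷ children-Q H

    children-length : ∀ {n xs} (H : All (HasChild Q) xs) → All (λ t → length t ≡ n) xs →
                      All (λ y → length y ≡ suc n) (children H)
    children-length []                                              []         = []
    children-length {xs = t ∷ _} ((_ , (_ , k , refl) , _) ∷ H) (refl ∷ L) =
      length-snoc t k ∷ children-length H L

    successor-of-children : ∀ a → All (HasChild Q) (elems a) →
                            ∃ λ b → GSucc T a b × All Q (elems b)
    successor-of-children a H = b , (refl , p[b]≐a) , children-Q H
      where
      predN-unique : Unique (map predN (children H))
      predN-unique = subst Unique (sym (predN-children H)) (unique a)

      b : GElem T
      b = record { level = suc (level a) ; elems = children H ; inT = children-mem H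
                 ; len = children-length {level a} H (len a) ; unique = map⁻ predN-unique }

      p[b]≐a : SetEq (pSet (children H)) (elems a)
      p[b]≐a = subst (SetEq (pSet (children H))) (predN-children H)
                     (pSet-unique (children H) predN-unique)

  rank-elems : ∀ α a → RankGE (GSucc T) a α → All (λ t → RankGE (TSucc T) t α) (elems a)
  rank-elems zer      a _ = All.universal (λ _ → tt) (elems a)
  rank-elems (lim f)  a r = All.tabulate (λ t∈a n → All.lookup (rank-elems (f n) a (r n)) t∈a)
  rank-elems (osuc α) a (b , a→b , r) = All.tabulate λ t∈a →
    let y , y∈b , t→y = child-in-successor {a} {b} a→b t∈a
    in  y , t→y , All.lookup (rank-elems α b r) y∈b

  rank-from-elems : ∀ α a → All (λ t → RankGE (TSucc T) t α) (elems a) → RankGE (GSucc T) a α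
  rank-from-elems zer      a _ = tt
  rank-from-elems (lim f)  a H n = rank-from-elems (f n) a (All.map (λ r → r n) H)
  rank-from-elems (osuc α) a H =
    let b , a→b , rb = successor-of-children a H
    in  b , a→b , rank-from-elems α b rb

lemma3p3 : (T : Tree) (a : GElem T) → 1 ≤ level a → ¬ (elems a ≡ []) →
    ∀ (α : Ord) → RankGE (GSucc T) a α ⇔ All (λ t → RankGE (TSucc T) t α) (elems a)
lemma3p3 T a _ _ α = mk⇔ (rank-elems T α a) (rank-from-elems T α a)
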